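{- Let $\kappa$ be a cardinal, $\mathcal{I}$ an injective $\Omega_\kappa$-system, $X\subseteq\omega^\kappa$, $g\in\omega^\kappa$, and $n$ a positive integer, and suppose every $n$-coherent family corresponding to $\mathcal{I}$ indexed by $X^n$ is type $I$ trivial. Then every family corresponding to $\mathcal{I}$ indexed by $X^n$ which is $n$-coherent below $g$ is trivial below $g$.
   Context: An $\Omega_\kappa$-system $\mathcal{I}$: abelian groups $I_{\alpha,k}$ ($\alpha<\kappa,k<\omega$) with compatible homomorphisms $p_{\alpha,j,k}$ ($j\ge k$); $I_x=\bigoplus_\alpha I_{\alpha,x(\alpha)}\subseteq\overline{I}_x=\prod_\alpha I_{\alpha,x(\alpha)}$, with maps $p_{y,x}=\prod_\alpha p_{\alpha,y(\alpha),x(\alpha)}$ for $x\le y$ pointwise. $\mathcal{I}$ is injective if for all morphisms (families of homomorphisms commuting with structure maps) $\varphi\colon\mathcal{G}\to\mathcal{I}$, $\psi\colon\mathcal{G}\to\mathcal{H}$ with each $\psi_{\alpha,k}$ injective, there is $\overline\varphi$ with $\overline\varphi\psi=\varphi$. $\bigwedge$ is pointwise minimum. A family indexed by $X^n$ is an alternating $\Phi=\langle\varphi_{\vec f}\mid\vec f\in X^n\rangle$ (i.e. $\varphi$ changes by $\mathrm{sgn}(\sigma)$ under permutation $\sigma$ of the entries). It is $n$-coherent if $\varphi_{\vec f}\in\overline{I}_{\bigwedge\vec f}$ and for every $(x_0,\dots,x_n)\in X^{n+1}$, $\sum_i(-1)^ip\,\varphi_{x_0\dots\widehat{x_i}\dots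 x_n}\in I_{\bigwedge x_j}$ (with $p$ the structure maps to $\overline{I}_{\bigwedge_j x_j}$). It is type $I$ trivial if for $n=1$ there is a compatible $\psi=(\psi_x)_{x\in\omega^\kappa}\in\lim\overline{I}$ with $\varphi_f-\psi_f\in I_f$ for all $f\in X$, and for $n>1$ there is an alternating $\Psi=\langle\psi_{\vec h}\in\overline{I}_{\bigwedge\vec h}\mid \vec h\in(\omega^\kappa)^{n-1}\rangle$ with $\varphi_{\vec f}-\sum_i(-1)^ip\,\psi_{\vec f^i}\in I_{\bigwedge\vec f}$ for all $\vec f\in X^n$ ($\vec f^i$ = $\vec f$ with $i$-th entry removed). "$n$-coherent below $g$" and "trivial below $g$" are the same notions with every $\overline{I}_{\bigwedge\vec f}$, $I_{\bigwedge\vec f}$ replaced by $\overline{I}_{\bigwedge\vec f\wedge g}$, $I_{\bigwedge\vec f\wedge g}$, except that for $n=1$ the trivialization is a single $\psi\in\overline{I}_g$ with $\varphi_f-p_{g,f\wedge g}\psi\in I_{f\wedge g}$ for all $f\in X$, and for $n>1$ it is a family $\Psi=\langle\psi_{\vec h}\in\overline{I}_{\bigwedge\vec h\wedge g}\rangle$. -}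

module Defs where

open import Level using (Level; _⊔_) renaming (suc to lsuc)
open import Data.Nat using (ℕ; zero; suc; _≤_; _⊓_)
open import Data.Nat.Properties using (≤-refl; ≤-trans; ⊓-glb; m⊓n≤m; m⊓n≤n; ⊓-mono-≤)
open import Data.Fin using (Fin; zero; suc; punchIn)
open import Data.Fin.Permutation using (Permutation′; transpose; _⟨$⟩ʳ_; _⟨$⟩ˡ_; inverseʳ)
open import Data.List using (List)
open import Data.List.Membership.Propositional using (_∉_)
open import Data.Product using (Σ; _×_; _,_)
open import Algebra.Bundles using (AbelianGroup)
open import Relation.Binary.PropositionalEquality using (_≡_; _≢_; subst)
open import Function using (_∘_)

Car : ∀ {c ℓ} → AbelianGroup c ℓ → Set c
Car G = AbelianGroup.Carrier G

Eq : ∀ {c ℓ} (G : AbelianGroup c ℓ) → Car G → Car G → Set ℓ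
Eq G = AbelianGroup._≈_ G

record IsHom {c ℓ} (G H : AbelianGroup c ℓ) (f : Car G → Car H) : Set (c ⊔ ℓ) where
  field
    cong : ∀ {a b} → Eq G a b → Eq H (f a) (f b)
    hom  : ∀ a b → Eq H (f (AbelianGroup._∙_ G a b)) (AbelianGroup._∙_ H (f a) (f b))

-- alternating sum  Σ_i (-1)^i a_i  = a_0 - (a_1 - (a_2 - ...))
altSum : ∀ {c ℓ} (G : AbelianGroup c ℓ) {m : ℕ} → (Fin m → Car G) → Car G
altSum G {zero} a = AbelianGroup.ε G
altSum G {suc m} a = AbelianGroup._∙_ G (a zero) (AbelianGroup._⁻¹ G (altSum G (a ∘ suc)))

-- Ω_κ-systems (κ represented by an index set K)

Le : {K : Set} → (K → ℕ) → (K → ℕ) → Set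
Le x y = ∀ α → x α ≤ y α

record System (K : Set) (c ℓ : Level) : Set (lsuc (c ⊔ ℓ)) where
  field
    grp    : K → ℕ → AbelianGroup c ℓ
    -- p α h = p_{α,j,k} for h : k ≤ j
    p      : ∀ α {j k} → k ≤ j → Car (grp α j) → Car (grp α k)
    p-hom  : ∀ α {j k} (h : k ≤ j) → IsHom (grp α j) (grp α k) (p α h)
    p-id   : ∀ α k (h : k ≤ k) (a : Car (grp α k)) → Eq (grp α k) (p α h a) a
    p-comp : ∀ α {l j k} (h₁ : j ≤ l) (h₂ : k ≤ j) (h₃ : k ≤ l) (a : Car (grp α l)) →
             Eq (grp α k) (p α h₂ (p α h₁ a)) (p α h₃ a)

record Morphism {K : Set} {c ℓ} (G H : System K c ℓ) : Set (c ⊔ ℓ) where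
  private
    module G = System G
    module H = System H
  field
    map     : ∀ α k → Car (G.grp α k) → Car (H.grp α k)
    map-hom : ∀ α k → IsHom (G.grp α k) (H.grp α k) (map α k)
    commute : ∀ α {j k} (h : k ≤ j) (a : Car (G.grp α j)) →
              Eq (H.grp α k) (map α k (G.p α h a)) (H.p α h (map α j a))

open Morphism public using (map)

Injective : {K : Set} {c ℓ : Level} → System K c ℓ → Set (lsuc (c ⊔ ℓ))
Injective {K} {c} {ℓ} I =
  (G H : System K c ℓ) (φ : Morphism G I) (ψ : Morphism G H) →
  (∀ α k a b → Eq (System.grp H α k) (map ψ α k a) (map ψ α k b) → Eq (System.grp G α k) a b) →
  Σ (Morphism H I) λ φ̄ → ∀ α k a → Eq (System.grp I α k) (map φ̄ α k (map ψ α k a)) (map φ α k a)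

module _ {K : Set} {c ℓ : Level} (I : System K c ℓ) where
  open System I

  Ibar : (K → ℕ) → Set c
  Ibar x = (α : K) → Car (grp α (x α))

  EqBar : (x : K → ℕ) → Ibar x → Ibar x → Set ℓ
  EqBar x a b = ∀ α → Eq (grp α (x α)) (a α) (b α)

  negBar : (x : K → ℕ) → Ibar x → Ibar x
  negBar x a α = AbelianGroup._⁻¹ (grp α (x α)) (a α)

  subBar : (x : K → ℕ) → Ibar x → Ibar x → Ibar x
  subBar x a b α = AbelianGroup._∙_ (grp α (x α)) (a α) (AbelianGroup._⁻¹ (grp α (x α)) (b α))

  altSumBar : (x : K → ℕ) {m : ℕ} → (Fin m → Ibar x) → Ibar x
  altSumBar x a α = altSum (grp α (x α)) (λ i → a i α)

  pbar : {x y : K → ℕ} → Le y x → Ibar x → Ibar y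
  pbar h a α = p α (h α) (a α)

  -- membership in the direct sum I_x ⊆ Ī_x : finite support
  InI : (x : K → ℕ) → Ibar x → Set ℓ
  InI x a = Σ (List K) λ L → ∀ α → α ∉ L → Eq (grp α (x α)) (a α) (AbelianGroup.ε (grp α (x α)))

minN : {m : ℕ} → (Fin (suc m) → ℕ) → ℕ
minN {zero} f = f zero
minN {suc m} f = f zero ⊓ minN (f ∘ suc)

meet : {K : Set} {m : ℕ} → (Fin (suc m) → (K → ℕ)) → K → ℕ
meet f α = minN (λ i → f i α)

minN-lb : {m : ℕ} (f : Fin (suc m) → ℕ) (i : Fin (suc m)) → minN f ≤ f i
minN-lb {zero} f zero = ≤-refl
minN-lb {suc m} f zero = m⊓n≤m _ _
minN-lb {suc m} f (suc i) = ≤-trans (m⊓n≤n _ _) (minN-lb (f ∘ suc) i)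

minN-glb : {m : ℕ} (f : Fin (suc m) → ℕ) (n : ℕ) → (∀ i → n ≤ f i) → n ≤ minN f
minN-glb {zero} f n h = h zero
minN-glb {suc m} f n h = ⊓-glb (h zero) (minN-glb (f ∘ suc) n (h ∘ suc))

meet-comp : {K : Set} {m k : ℕ} (f : Fin (suc m) → (K → ℕ)) (g : Fin (suc k) → Fin (suc m)) →
            Le (meet f) (meet (f ∘ g))
meet-comp f g α = minN-glb _ _ (λ i → minN-lb (λ j → f j α) (g i))

meet-perm : {K : Set} {m : ℕ} (f : Fin (suc m) → (K → ℕ)) (σ : Permutation′ (suc m)) →
            Le (meet (λ i → f (σ ⟨$⟩ʳ i))) (meet f)
meet-perm f σ α = minN-glb _ _ λ i →
  subst (λ j → minN (λ k → f (σ ⟨$⟩ʳ k) α) ≤ f j α) (inverseʳ σ)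
        (minN-lb (λ k → f (σ ⟨$⟩ʳ k) α) (σ ⟨$⟩ˡ i))

-- Families.  A "cap" operation c on ω^κ is either the identity (plain
-- notions) or  x ↦ x ∧ g  (notions "below g"); cm is its monotonicity.

Mono : {K : Set} → ((K → ℕ) → (K → ℕ)) → Set
Mono cap = ∀ {x y} → Le x y → Le (cap x) (cap y)

idCap : {K : Set} → (K → ℕ) → (K → ℕ)
idCap x = x

idCap-mono : {K : Set} → Mono {K} idCap
idCap-mono h = h

below : {K : Set} → (K → ℕ) → (K → ℕ) → (K → ℕ)
below g x α = x α ⊓ g α

below-mono : {K : Set} (g : K → ℕ) → Mono (below g)
below-mono g h α = ⊓-mono-≤ (h α) ≤-refl

module _ {K : Set} {c ℓ : Level} (I : System K c ℓ)
         (cap : (K → ℕ) → (K → ℕ)) (cm : Mono cap) where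

  -- a family indexed by Y^(suc m) (Y embedded into ω^κ by e), with
  -- φ_f ∈ Ī_{cap (⋀ f)}
  Family : (Y : Set) (e : Y → (K → ℕ)) (m : ℕ) → Set c
  Family Y e m = (f : Fin (suc m) → Y) → Ibar I (cap (meet (e ∘ f)))

  -- alternating: swapping two distinct entries changes the sign
  -- (equivalently, φ changes by sgn σ under every permutation σ)
  Alternating : {Y : Set} {e : Y → (K → ℕ)} {m : ℕ} → Family Y e m → Set ℓ
  Alternating {Y} {e} {m} φ =
    ∀ (f : Fin (suc m) → Y) (i j : Fin (suc m)) → i ≢ j →
    let σ = transpose i j in
    EqBar I (cap (meet (λ k → e (f (σ ⟨$⟩ʳ k)))))
      (φ (λ k → f (σ ⟨$⟩ʳ k)))
      (negBar I _ (pbar I (cm (meet-perm (e ∘ f) σ)) (φ f)))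

  CoherenceCondition : {Y : Set} {e : Y → (K → ℕ)} {m : ℕ} → Family Y e m → Set ℓ
  CoherenceCondition {Y} {e} {m} φ =
    ∀ (x : Fin (suc (suc m)) → Y) →
    InI I (cap (meet (e ∘ x)))
      (altSumBar I (cap (meet (e ∘ x)))
        (λ i → pbar I (cm (meet-comp (e ∘ x) (punchIn i))) (φ (x ∘ punchIn i))))

  Coherent : {Y : Set} {e : Y → (K → ℕ)} {m : ℕ} → Family Y e m → Set ℓ
  Coherent {Y} {e} φ = Alternating {Y} {e} φ × CoherenceCondition {Y} {e} φ

-- n-coherent (n = suc m) and type I trivial, for X ⊆ ω^κ given by ι

module _ {K : Set} {c ℓ : Level} (I : System K c ℓ) (X : Set) (ι : X → (K → ℕ)) where

  NCoherent : (m : ℕ) → Family I idCap idCap-mono X ι m → Set ℓ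
  NCoherent m φ = Coherent I idCap idCap-mono {X} {ι} φ

  TrivialI : (m : ℕ) → Family I idCap idCap-mono X ι m → Set (c ⊔ ℓ)
  TrivialI zero φ =
    Σ ((x : K → ℕ) → Ibar I x) λ ψ →
      (∀ x y (h : Le y x) → EqBar I y (pbar I h (ψ x)) (ψ y)) ×
      (∀ (f : X) → InI I (ι f) (subBar I (ι f) (φ (λ _ → f)) (ψ (ι f))))
  TrivialI (suc k) φ =
    Σ (Family I idCap idCap-mono (K → ℕ) idCap k) λ Ψ →
      Alternating I idCap idCap-mono {K → ℕ} {idCap} Ψ ×
      (∀ (f : Fin (suc (suc k)) → X) →
        InI I (meet (ι ∘ f))
          (subBar I (meet (ι ∘ f)) (φ f)
            (altSumBar I (meet (ι ∘ f))
              (λ i → pbar I (meet-comp (ι ∘ f) (punchIn i)) (Ψ (ι ∘ f ∘ punchIn i))))))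

  NCoherentBelow : (g : K → ℕ) (m : ℕ) → Family I (below g) (below-mono g) X ι m → Set ℓ
  NCoherentBelow g m φ = Coherent I (below g) (below-mono g) {X} {ι} φ

  TrivialBelow : (g : K → ℕ) (m : ℕ) → Family I (below g) (below-mono g) X ι m → Set (c ⊔ ℓ)
  TrivialBelow g zero φ =
    Σ (Ibar I g) λ ψ →
      ∀ (f : X) → InI I (below g (ι f))
        (subBar I (below g (ι f)) (φ (λ _ → f)) (pbar I (λ α → m⊓n≤n (ι f α) (g α)) ψ))
  TrivialBelow g (suc k) φ =
    Σ (Family I (below g) (below-mono g) (K → ℕ) idCap k) λ Ψ →
      Alternating I (below g) (below-mono g) {K → ℕ} {idCap} Ψ ×
      (∀ (f : Fin (suc (suc k)) → X) →
        InI I (below g (meet (ι ∘ f)))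
          (subBar I (below g (meet (ι ∘ f))) (φ f)
            (altSumBar I (below g (meet (ι ∘ f)))
              (λ i → pbar I (below-mono g (meet-comp (ι ∘ f) (punchIn i))) (Ψ (ι ∘ f ∘ punchIn i))))))

-- Families below g for I are, definitionally, the families for the restricted
-- system I↾g (restrict I g) with (I↾g)_{α,k} = I_{α,k∧g(α)}.  The restriction
-- r : I → I↾g is injective on the part of I at levels ≤ g, and injectivity of I
-- extends its inverse there to a section s : I↾g → I.  Pushing a family
-- coherent below g along s gives a coherent family for I, which is trivial by
-- hypothesis; pushing the trivialisation back along r, and using r ∘ s = id,
-- trivialises the original family.
module Submission where

open import Defs
open import Level using (Level; _⊔_)
open import Data.Nat using (ℕ; zero; suc; _≤_; _⊓_; _≤?_)
open import Data.Nat.Properties using (≤-refl; ≤-trans; m⊓n≤m; m⊓n≤n; ⊓-glb; ⊓-mono-≤)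
open import Data.Fin using (Fin; zero; suc; punchIn)
open import Data.Product using (Σ; _,_; proj₁; proj₂)
open import Algebra.Bundles using (AbelianGroup)
import Algebra.Properties.Group as GroupProperties
open import Relation.Binary.PropositionalEquality using (_≡_)
import Relation.Binary.Reasoning.Setoid as SetoidReasoning
open import Relation.Nullary using (Dec; yes; no)
open import Data.Empty using (⊥-elim)
open import Function using (_∘_)

module _ {c ℓ} {G H : AbelianGroup c ℓ} {f : Car G → Car H} (f-hom : IsHom G H f) where
  private
    module G = AbelianGroup G
    module H = AbelianGroup H
  open IsHom f-hom

  ε-homo : H._≈_ (f G.ε) H.ε
  ε-homo = GroupProperties.identityˡ-unique H.group (f G.ε) (f G.ε)
             (H.trans (H.sym (hom G.ε G.ε)) (cong (G.identityˡ G.ε)))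

  ⁻¹-homo : ∀ a → H._≈_ (f (a G.⁻¹)) (f a H.⁻¹)
  ⁻¹-homo a = GroupProperties.inverseˡ-unique H.group (f (a G.⁻¹)) (f a)
                (H.trans (H.sym (hom (a G.⁻¹) a)) (H.trans (cong (G.inverseˡ a)) ε-homo))

  sub-homo : ∀ a b → H._≈_ (f (a G.∙ b G.⁻¹)) (f a H.∙ f b H.⁻¹)
  sub-homo a b = H.trans (hom a (b G.⁻¹)) (H.∙-cong H.refl (⁻¹-homo b))

  altSum-homo : ∀ {m} (v : Fin m → Car G) → H._≈_ (f (altSum G v)) (altSum H (f ∘ v))
  altSum-homo {zero} v = ε-homo
  altSum-homo {suc m} v = H.trans (sub-homo (v zero) (altSum G (v ∘ suc)))
                            (H.∙-cong H.refl (H.⁻¹-cong (altSum-homo (v ∘ suc))))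

IsHom-∘ : ∀ {c ℓ} {G H L : AbelianGroup c ℓ} {f : Car G → Car H} {h : Car H → Car L} →
          IsHom H L h → IsHom G H f → IsHom G L (h ∘ f)
IsHom-∘ {L = L} h-hom f-hom = record
  { cong = IsHom.cong h-hom ∘ IsHom.cong f-hom
  ; hom  = λ a b → AbelianGroup.trans L (IsHom.cong h-hom (IsHom.hom f-hom a b)) (IsHom.hom h-hom _ _)
  }

altSum-cong : ∀ {c ℓ} (G : AbelianGroup c ℓ) {m} {v w : Fin m → Car G} →
              (∀ i → Eq G (v i) (w i)) → Eq G (altSum G v) (altSum G w)
altSum-cong G {zero} e = AbelianGroup.refl G
altSum-cong G {suc m} e = AbelianGroup.∙-cong G (e zero) (AbelianGroup.⁻¹-cong G (altSum-cong G (e ∘ suc)))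

-- A when P holds, the trivial group when P fails.
module _ {c ℓ} (A : AbelianGroup c ℓ) where
  open AbelianGroup A

  guarded : Set → AbelianGroup c ℓ
  guarded P = record
    { Carrier        = Carrier
    ; _≈_            = λ a b → P → a ≈ b
    ; _∙_            = _∙_
    ; ε              = ε
    ; _⁻¹            = _⁻¹
    ; isAbelianGroup = record
      { isGroup = record
        { isMonoid = record
          { isSemigroup = record
            { isMagma = record
              { isEquivalence = record
                { refl  = λ _ → refl
                ; sym   = λ e q → sym (e q)
                ; trans = λ e e′ q → trans (e q) (e′ q)
                }
              ; ∙-cong = λ e e′ q → ∙-cong (e q) (e′ q)
              }
            ; assoc = λ a b d _ → assoc a b d
            }
          ; identity = (λ a _ → identityˡ a) , (λ a _ → identityʳ a)
          }
        ; inverse = (λ a _ → inverseˡ a) , (λ a _ → inverseʳ a)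
        ; ⁻¹-cong = λ e q → ⁻¹-cong (e q)
        }
      ; comm = λ a b _ → comm a b
      }
    }

  IsHom-guarded : ∀ {G : AbelianGroup c ℓ} {f : Car G → Carrier} {P : Set} →
                  IsHom G A f → IsHom G (guarded P) f
  IsHom-guarded f-hom = record
    { cong = λ e _ → IsHom.cong f-hom e
    ; hom  = λ a b _ → IsHom.hom f-hom a b
    }

  keepIf : {P : Set} → Dec P → Carrier → Carrier
  keepIf (yes _) a = a
  keepIf (no _)  _ = ε

  keepIf-hom : {P : Set} (d : Dec P) → IsHom (guarded P) A (keepIf d)
  keepIf-hom (yes p) = record { cong = λ e → e p ; hom = λ _ _ → refl }
  keepIf-hom (no _)  = record { cong = λ _ → refl ; hom = λ _ _ → sym (identityˡ ε) }

  keepIf-id : {P : Set} (d : Dec P) → P → ∀ a → keepIf d a ≈ a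
  keepIf-id (yes _) _ a = refl
  keepIf-id (no ¬p) p _ = ⊥-elim (¬p p)

module SystemProperties {K : Set} {c ℓ} (A : System K c ℓ) where
  open System A

  p-antisym : ∀ α {j l} (h₁ : j ≤ l) (h₂ : l ≤ j) a → Eq (grp α j) (p α h₁ (p α h₂ a)) a
  p-antisym α h₁ h₂ a = AbelianGroup.trans (grp α _) (p-comp α h₂ h₁ ≤-refl a) (p-id α _ ≤-refl a)

  InI-resp : ∀ x {a b} → EqBar A x a b → InI A x a → InI A x b
  InI-resp x e (L , a≈ε) = L , λ α α∉L →
    AbelianGroup.trans (grp α (x α)) (AbelianGroup.sym (grp α (x α)) (e α)) (a≈ε α α∉L)

  subBar-cong : ∀ x {a a′ b b′} → EqBar A x a a′ → EqBar A x b b′ →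
                EqBar A x (subBar A x a b) (subBar A x a′ b′)
  subBar-cong x e e′ α = AbelianGroup.∙-cong (grp α (x α)) (e α) (AbelianGroup.⁻¹-cong (grp α (x α)) (e′ α))

  TrivialI-suc-resp : (X : Set) (ι : X → K → ℕ) (k : ℕ) {φ φ′ : Family A idCap idCap-mono X ι (suc k)} →
                      (∀ f → EqBar A _ (φ′ f) (φ f)) → TrivialI A X ι (suc k) φ′ → TrivialI A X ι (suc k) φ
  TrivialI-suc-resp X ι k φ′≈φ (Ψ , Ψ-alt , triv) =
    Ψ , Ψ-alt , λ f → InI-resp _ (subBar-cong _ (φ′≈φ f) (λ α → AbelianGroup.refl (grp α _))) (triv f)

_∘ᴹ_ : ∀ {K : Set} {c ℓ} {A B C : System K c ℓ} → Morphism B C → Morphism A B → Morphism A C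
_∘ᴹ_ {C = C} M N = record
  { map     = λ α k → map M α k ∘ map N α k
  ; map-hom = λ α k → IsHom-∘ (Morphism.map-hom M α k) (Morphism.map-hom N α k)
  ; commute = λ α h a → AbelianGroup.trans (System.grp C α _)
                (IsHom.cong (Morphism.map-hom M α _) (Morphism.commute N α h a))
                (Morphism.commute M α h (map N α _ a))
  }

IsSection : ∀ {K : Set} {c ℓ} {A B : System K c ℓ} → Morphism B A → Morphism A B → Set (c ⊔ ℓ)
IsSection {B = B} s r = ∀ α k a → Eq (System.grp B α k) (map r α k (map s α k a)) a

module _ {K : Set} {c ℓ} {A B : System K c ℓ} (M : Morphism A B) where
  private
    module A = System A
    module B = System B
    module M = Morphism M
    module BG α k = AbelianGroup (B.grp α k)

  mapBar : (x : K → ℕ) → Ibar A x → Ibar B x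
  mapBar x a α = map M α (x α) (a α)

  mapFamily : {Y : Set} (e : Y → K → ℕ) {m : ℕ} →
              Family A idCap idCap-mono Y e m → Family B idCap idCap-mono Y e m
  mapFamily e φ f = mapBar _ (φ f)

  mapBar-InI : ∀ x {a} → InI A x a → InI B x (mapBar x a)
  mapBar-InI x (L , a≈ε) = L , λ α α∉L →
    BG.trans α _ (IsHom.cong (M.map-hom α _) (a≈ε α α∉L)) (ε-homo (M.map-hom α _))

  mapBar-altSum : (x : K → ℕ) {m : ℕ} {y : Fin m → K → ℕ} (h : ∀ i → Le x (y i)) (v : ∀ i → Ibar A (y i)) →
                  EqBar B x (mapBar x (altSumBar A x (λ i → pbar A (h i) (v i))))
                            (altSumBar B x (λ i → pbar B (h i) (mapBar (y i) (v i))))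
  mapBar-altSum x h v α = BG.trans α _ (altSum-homo (M.map-hom α _) (λ i → pbar A (h i) (v i) α))
    (altSum-cong (B.grp α (x α)) (λ i → M.commute α (h i α) (v i α)))

  map-Alternating : {Y : Set} {e : Y → K → ℕ} {m : ℕ} (φ : Family A idCap idCap-mono Y e m) →
                    Alternating A idCap idCap-mono {Y} {e} φ →
                    Alternating B idCap idCap-mono {Y} {e} (mapFamily e φ)
  map-Alternating φ φ-alt f i j i≢j α =
    BG.trans α _ (IsHom.cong (M.map-hom α _) (φ-alt f i j i≢j α))
      (BG.trans α _ (⁻¹-homo (M.map-hom α _) _) (BG.⁻¹-cong α _ (M.commute α _ _)))

  map-CoherenceCondition : {Y : Set} {e : Y → K → ℕ} {m : ℕ} (φ : Family A idCap idCap-mono Y e m) →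
                           CoherenceCondition A idCap idCap-mono {Y} {e} φ →
                           CoherenceCondition B idCap idCap-mono {Y} {e} (mapFamily e φ)
  map-CoherenceCondition {e = e} φ φ-coh x =
    SystemProperties.InI-resp B _
      (mapBar-altSum _ (λ i → meet-comp (e ∘ x) (punchIn i)) (λ i → φ (x ∘ punchIn i)))
      (mapBar-InI _ (φ-coh x))

  map-NCoherent : (X : Set) (ι : X → K → ℕ) (m : ℕ) (φ : Family A idCap idCap-mono X ι m) →
                  NCoherent A X ι m φ → NCoherent B X ι m (mapFamily ι φ)
  map-NCoherent X ι m φ (φ-alt , φ-coh) = map-Alternating {e = ι} φ φ-alt , map-CoherenceCondition {e = ι} φ φ-coh

  map-TrivialI-suc : (X : Set) (ι : X → K → ℕ) (k : ℕ) {φ : Family A idCap idCap-mono X ι (suc k)} →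
                     TrivialI A X ι (suc k) φ → TrivialI B X ι (suc k) (mapFamily ι φ)
  map-TrivialI-suc X ι k (Ψ , Ψ-alt , triv) = mapFamily idCap Ψ , map-Alternating {e = idCap} Ψ Ψ-alt , λ f →
    SystemProperties.InI-resp B _
      (λ α → BG.trans α _ (sub-homo (M.map-hom α _) _ _)
        (BG.∙-cong α _ (BG.refl α _) (BG.⁻¹-cong α _
          (mapBar-altSum _ (λ i → meet-comp (ι ∘ f) (punchIn i)) (λ i → Ψ (ι ∘ f ∘ punchIn i)) α))))
      (mapBar-InI _ (triv f))

module _ {K : Set} {c ℓ} (I : System K c ℓ) (g : K → ℕ) where
  private
    module I = System I

  restrict : System K c ℓ
  restrict = record
    { grp    = λ α k → I.grp α (k ⊓ g α)
    ; p      = λ α h → I.p α (⊓-mono-≤ h ≤-refl)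
    ; p-hom  = λ α h → I.p-hom α _
    ; p-id   = λ α k h → I.p-id α (k ⊓ g α) _
    ; p-comp = λ α h₁ h₂ h₃ → I.p-comp α _ _ _
    }

  restriction : Morphism I restrict
  restriction = record
    { map     = λ α k → I.p α (m⊓n≤m k (g α))
    ; map-hom = λ α k → I.p-hom α _
    ; commute = λ α {j} {k} h a → AbelianGroup.trans (I.grp α _)
                  (I.p-comp α h (m⊓n≤m k (g α)) (≤-trans (m⊓n≤m k (g α)) h) a)
                  (AbelianGroup.sym (I.grp α _) (I.p-comp α _ _ _ a))
    }

module _ {K : Set} {c ℓ} (I : System K c ℓ) (g : K → ℕ) where
  private
    module I = System I
    module IG α k = AbelianGroup (I.grp α k)
    module r = Morphism (restriction I g)
    open SystemProperties I

  keep : ∀ α k → Car (I.grp α k) → Car (I.grp α k)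
  keep α k = keepIf (I.grp α k) (k ≤? g α)

  keep-absorb : ∀ α {j k} (h : k ≤ j) a → Eq (I.grp α k) (keep α k (I.p α h (keep α j a))) (I.p α h (keep α j a))
  keep-absorb α {j} {k} h a with j ≤? g α
  ... | yes j≤g = keepIf-id (I.grp α k) (k ≤? g α) (≤-trans h j≤g) _
  ... | no _    = IG.trans α k (IsHom.cong (keepIf-hom (I.grp α k) (k ≤? g α)) (λ _ → ε-homo (I.p-hom α h)))
                    (IG.trans α k (ε-homo (keepIf-hom (I.grp α k) (k ≤? g α))) (IG.sym α k (ε-homo (I.p-hom α h))))

  truncate : System K c ℓ
  truncate = record
    { grp    = λ α k → guarded (I.grp α k) (k ≤ g α)
    ; p      = λ α {j} h → I.p α h ∘ keep α j
    ; p-hom  = λ α {j} h → IsHom-guarded (I.grp α _) (IsHom-∘ (I.p-hom α h) (keepIf-hom (I.grp α j) (j ≤? g α)))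
    ; p-id   = λ α k h a k≤g → IG.trans α k (IsHom.cong (I.p-hom α h) (keepIf-id (I.grp α k) (k ≤? g α) k≤g a))
                                  (I.p-id α k h a)
    ; p-comp = λ α h₁ h₂ h₃ a _ → IG.trans α _ (IsHom.cong (I.p-hom α h₂) (keep-absorb α h₁ a)) (I.p-comp α h₁ h₂ h₃ (keep α _ a))
    }

  embed : Morphism truncate I
  embed = record
    { map     = keep
    ; map-hom = λ α k → keepIf-hom (I.grp α k) (k ≤? g α)
    ; commute = keep-absorb
    }

  restriction-injective : ∀ α {k} → k ≤ g α → ∀ {a b} →
    Eq (I.grp α (k ⊓ g α)) (r.map α k a) (r.map α k b) → Eq (I.grp α k) a b
  restriction-injective α {k} k≤g {a} {b} ra≈rb = begin
    a                          ≈⟨ IG.sym α k (p-antisym α k≤k⊓g (m⊓n≤m k (g α)) a) ⟩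
    I.p α k≤k⊓g (r.map α k a)  ≈⟨ IsHom.cong (I.p-hom α k≤k⊓g) ra≈rb ⟩
    I.p α k≤k⊓g (r.map α k b)  ≈⟨ p-antisym α k≤k⊓g (m⊓n≤m k (g α)) b ⟩
    b                          ∎
    where
    k≤k⊓g = ⊓-glb ≤-refl k≤g
    open SetoidReasoning (IG.setoid α k)

  restriction-embed-injective : ∀ α k a b →
    Eq (I.grp α (k ⊓ g α)) (r.map α k (keep α k a)) (r.map α k (keep α k b)) → Eq (guarded (I.grp α k) (k ≤ g α)) a b
  restriction-embed-injective α k a b r-keep≈ k≤g =
    restriction-injective α k≤g (IG.trans α _ (IsHom.cong (r.map-hom α k) (IG.sym α k (keep≈id a)))
                                  (IG.trans α _ r-keep≈ (IsHom.cong (r.map-hom α k) (keep≈id b))))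
    where
    keep≈id = keepIf-id (I.grp α k) (k ≤? g α) k≤g

  restriction-section : Injective I → Σ (Morphism (restrict I g) I) λ s → IsSection s (restriction I g)
  restriction-section inj = s , r∘s≈id
    where
    extension = inj truncate (restrict I g) embed (restriction I g ∘ᴹ embed) restriction-embed-injective
    s = proj₁ extension
    module s = Morphism s

    r∘s≈id : IsSection s (restriction I g)
    r∘s≈id α k a = begin
      r.map α k (s.map α k a)               ≈⟨ IG.sym α k′ (s.commute α k′≤k a) ⟩
      s.map α k′ x                          ≈⟨ IsHom.cong (s.map-hom α k′) (IG.sym α (k′ ⊓ g α) rb≈x) ⟩
      s.map α k′ (r.map α k′ (keep α k′ b)) ≈⟨ proj₂ extension α k′ b ⟩
      keep α k′ b                           ≈⟨ keepIf-id (I.grp α k′) (k′ ≤? g α) k′≤g b ⟩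
      b                                     ≈⟨ p-antisym α k′≤k′⊓g _ a ⟩
      a                                     ∎
      where
      open SetoidReasoning (IG.setoid α (k ⊓ g α))
      k′ = k ⊓ g α
      k′≤k = m⊓n≤m k (g α)
      k′≤g = m⊓n≤n k (g α)
      k′≤k′⊓g = ⊓-glb ≤-refl k′≤g
      x = System.p (restrict I g) α k′≤k a
      b = I.p α k′≤k′⊓g x
      rb≈x : Eq (I.grp α (k′ ⊓ g α)) (r.map α k′ (keep α k′ b)) x
      rb≈x = IG.trans α _ (IsHom.cong (r.map-hom α k′) (keepIf-id (I.grp α k′) (k′ ≤? g α) k′≤g b))
                          (p-antisym α (m⊓n≤m k′ (g α)) k′≤k′⊓g x)

module _ {K : Set} {c ℓ} (I : System K c ℓ) (g : K → ℕ)
         (s : Morphism (restrict I g) I)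
         (r∘s≈id : IsSection s (restriction I g))
         (X : Set) (ι : X → K → ℕ) where
  private
    module I = System I
    module IG α k = AbelianGroup (I.grp α k)
    r = restriction I g

  trivialBelow-section : ∀ m (φ : Family I (below g) (below-mono g) X ι m) →
                         TrivialI I X ι m (mapFamily s ι φ) → TrivialBelow I X ι g m φ
  trivialBelow-section zero φ (ψ , ψ-compatible , triv) = ψ g , λ f →
    SystemProperties.InI-resp I _ (r-sub f) (mapBar-InI r _ (triv f))
    where
    -- By compatibility of ψ, ψ (ι f) and ψ g have the same image in Ī_{f∧g}.
    r-sub : ∀ f → EqBar I (below g (ι f))
              (mapBar r (ι f) (subBar I (ι f) (mapBar s (ι f) (φ (λ _ → f))) (ψ (ι f))))
              (subBar I (below g (ι f)) (φ (λ _ → f)) (pbar I (λ α → m⊓n≤n (ι f α) (g α)) (ψ g)))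
    r-sub f α = IG.trans α _ (sub-homo (I.p-hom α _) _ _)
      (IG.∙-cong α _ (r∘s≈id α _ (φ (λ _ → f) α))
        (IG.⁻¹-cong α _ (IG.trans α _ (ψ-compatible (ι f) (below g (ι f)) (λ β → m⊓n≤m _ _) α)
                                       (IG.sym α _ (ψ-compatible g (below g (ι f)) (λ β → m⊓n≤n _ _) α)))))
  trivialBelow-section (suc k) φ triv =
    SystemProperties.TrivialI-suc-resp (restrict I g) X ι k (λ f α → r∘s≈id α _ (φ f α))
      (map-TrivialI-suc r X ι k triv)

proposition4p2 : {c ℓ : Level} (K : Set) (I : System K c ℓ) → Injective I →
    (X : Set) (ι : X → (K → ℕ)) → (∀ a b → ι a ≡ ι b → a ≡ b) →
    (g : K → ℕ) (m : ℕ) →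
    (∀ (φ : Family I idCap idCap-mono X ι m) → NCoherent I X ι m φ → TrivialI I X ι m φ) →
    ∀ (φ : Family I (below g) (below-mono g) X ι m) →
    NCoherentBelow I X ι g m φ → TrivialBelow I X ι g m φ
proposition4p2 K I inj X ι _ g m trivial φ coherentBelow =
  trivialBelow-section I g s r∘s≈id X ι m φ
    (trivial (mapFamily s ι φ) (map-NCoherent s X ι m φ coherentBelow))
  where
  section = restriction-section I g inj
  s = proj₁ section
  r∘s≈id = proj₂ section
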